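{- Let $m\geq 2$ be an integer. Then \[ \frac{m-j}{j+1} > \frac{d_{j+1}(m)}{d_j(m)}, \qquad 1\le j\le m-1. \]
   Context: For a nonnegative integer $m$ and $0\le i\le m$, the Boros-Moll coefficients are \[ d_i(m)=2^{ -2m}\sum_{k=i}^m 2^k\binom{2m-2k}{m-k}\binom{m+k}{k}\binom{k}{i}. \] -}

module Defs where

open import Data.Nat using (ℕ; zero; suc; _+_; _*_; _∸_; _^_)
open import Data.Nat.Combinatorics using (_C_)
open import Data.Integer using (+_)
open import Data.Rational using (ℚ; _/_)
open import Data.Nat.Properties using (m^n≢0)

sumBelow : ℕ → (ℕ → ℕ) → ℕ
sumBelow zero    f = 0
sumBelow (suc n) f = sumBelow n f + f n

-- the integer  Σ_{k=i}^{m} 2^k C(2m-2k, m-k) C(m+k, k) C(k, i)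
-- (the sum is reindexed as k = i + t, t = 0 .. m - i; empty if i > m)
dNum : ℕ → ℕ → ℕ
dNum m i = sumBelow (suc (m ∸ i)) (λ t →
  let k = i + t in
  (2 ^ k) * (((2 * m ∸ 2 * k) C (m ∸ k)) * (((m + k) C k) * (k C i))))

d : ℕ → ℕ → ℚ
d m i = _/_ (+ dNum m i) (2 ^ (2 * m)) {{m^n≢0 2 (2 * m)}}

-- Absorption, (i + 1) C(k, i + 1) = (k - i) C(k, i), turns the k-th summand of
-- (j + 1) d_{j+1}(m) into (k - j) times the k-th summand of d_j(m), and k - j ≤ m - j.
-- So (j + 1) d_{j+1}(m) ≤ (m - j) (d_j(m) - s), where s > 0 is the summand k = j of d_j(m),
-- which has no counterpart in d_{j+1}(m).
module Submission where

module BorosMollNumerator where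
  open import Defs
  open import Data.Nat
  open import Data.Nat.Properties
  open import Data.Nat.Combinatorics
  open import Data.Nat.Tactic.RingSolver
  open import Relation.Binary.PropositionalEquality

  sumBelow-shift : ∀ n f → sumBelow (suc n) f ≡ f 0 + sumBelow n (λ t → f (suc t))
  sumBelow-shift zero    f = +-comm 0 (f 0)
  sumBelow-shift (suc n) f =
    trans (cong (_+ f (suc n)) (sumBelow-shift n f)) (+-assoc (f 0) _ _)

  *-distribˡ-sumBelow : ∀ c n f → c * sumBelow n f ≡ sumBelow n (λ t → c * f t)
  *-distribˡ-sumBelow c zero    f = *-zeroʳ c
  *-distribˡ-sumBelow c (suc n) f =
    trans (*-distribˡ-+ c (sumBelow n f) (f n)) (cong (_+ c * f n) (*-distribˡ-sumBelow c n f))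

  sumBelow-mono-≤ : ∀ n f g → (∀ t → t < n → f t ≤ g t) → sumBelow n f ≤ sumBelow n g
  sumBelow-mono-≤ zero    f g f≤g = z≤n
  sumBelow-mono-≤ (suc n) f g f≤g =
    +-mono-≤ (sumBelow-mono-≤ n f g (λ t t<n → f≤g t (m<n⇒m<1+n t<n))) (f≤g n ≤-refl)

  nC0≡1 : ∀ n → n C 0 ≡ 1
  nC0≡1 n = trans (nCk≡nC[n∸k] {0} {n} z≤n) (nCn≡1 n)

  nCk>0 : ∀ {n k} → k ≤ n → 0 < n C k
  nCk>0 {n} {zero} _ rewrite nC0≡1 n = z<s
  nCk>0 {suc n} {suc k} (s≤s k≤n) rewrite sym (nCk+nC[k+1]≡[n+1]C[k+1] n k) =
    <-≤-trans (nCk>0 k≤n) (m≤m+n _ _)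

  [k+1]*nC[k+1]+k*nCk≡n*nCk : ∀ n k → suc k * (n C suc k) + k * (n C k) ≡ n * (n C k)
  [k+1]*nC[k+1]+k*nCk≡n*nCk zero zero = refl
  [k+1]*nC[k+1]+k*nCk≡n*nCk zero (suc k)
    rewrite k>n⇒nCk≡0 (z<s {suc k}) | k>n⇒nCk≡0 (z<s {k}) | *-zeroʳ k = refl
  [k+1]*nC[k+1]+k*nCk≡n*nCk (suc n) zero
    rewrite nC1≡n (suc n) | nC0≡1 (suc n) =
    trans (+-identityʳ _) (trans (*-identityˡ _) (sym (*-identityʳ _)))
  [k+1]*nC[k+1]+k*nCk≡n*nCk (suc n) (suc k)
    rewrite sym (nCk+nC[k+1]≡[n+1]C[k+1] n k) | sym (nCk+nC[k+1]≡[n+1]C[k+1] n (suc k)) = begin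
      suc (suc k) * (Y + Z) + suc k * (X + Y)                      ≡⟨ regroup k X Y Z ⟩
      Y + X + (suc (suc k) * Z + suc k * Y) + (suc k * Y + k * X)
        ≡⟨ cong₂ (λ u v → Y + X + u + v) ([k+1]*nC[k+1]+k*nCk≡n*nCk n (suc k))
                                          ([k+1]*nC[k+1]+k*nCk≡n*nCk n k) ⟩
      Y + X + n * Y + n * X                                        ≡⟨ collect n X Y ⟩
      suc n * (X + Y)                                              ∎
    where
    open ≡-Reasoning
    X = n C k
    Y = n C suc k
    Z = n C suc (suc k)
    regroup : ∀ k X Y Z → suc (suc k) * (Y + Z) + suc k * (X + Y)
                        ≡ Y + X + (suc (suc k) * Z + suc k * Y) + (suc k * Y + k * X)
    regroup = solve-∀
    collect : ∀ n X Y → Y + X + n * Y + n * X ≡ suc n * (X + Y)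
    collect = solve-∀

  absorption : ∀ n k → suc k * (n C suc k) ≡ (n ∸ k) * (n C k)
  absorption n k = begin
    suc k * (n C suc k)                             ≡⟨ m+n∸n≡m _ (k * (n C k)) ⟨
    suc k * (n C suc k) + k * (n C k) ∸ k * (n C k) ≡⟨ cong (_∸ k * (n C k)) ([k+1]*nC[k+1]+k*nCk≡n*nCk n k) ⟩
    n * (n C k) ∸ k * (n C k)                       ≡⟨ *-distribʳ-∸ (n C k) n k ⟨
    (n ∸ k) * (n C k)                               ∎
    where open ≡-Reasoning

  summand : ℕ → ℕ → ℕ → ℕ
  summand m i k = 2 ^ k * (((2 * m ∸ 2 * k) C (m ∸ k)) * (((m + k) C k) * (k C i)))

  dNum≡sumBelow-summand : ∀ m i → dNum m i ≡ sumBelow (suc (m ∸ i)) (λ t → summand m i (i + t))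
  dNum≡sumBelow-summand m i = refl

  summand>0 : ∀ {m i k} → i ≤ k → k ≤ m → 0 < summand m i k
  summand>0 {m} {i} {k} i≤k k≤m =
    m*n>0 (m^n>0 2 k) (m*n>0 (nCk>0 m∸k≤2m∸2k) (m*n>0 (nCk>0 (m≤n+m k m)) (nCk>0 i≤k)))
    where
    m*n>0 : ∀ {a b} → 0 < a → 0 < b → 0 < a * b
    m*n>0 {suc a} {suc b} _ _ = z<s
    m∸k≤2m∸2k : m ∸ k ≤ 2 * m ∸ 2 * k
    m∸k≤2m∸2k = subst (m ∸ k ≤_) (*-distribˡ-∸ 2 m k) (m≤n*m (m ∸ k) 2)

  summand-absorption : ∀ m i k → suc i * summand m (suc i) k ≡ (k ∸ i) * summand m i k
  summand-absorption m i k = begin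
    suc i * (a * (X * (Y * (k C suc i))))  ≡⟨ pull-in (suc i) a X Y _ ⟩
    a * (X * (Y * (suc i * (k C suc i))))  ≡⟨ cong (λ w → a * (X * (Y * w))) (absorption k i) ⟩
    a * (X * (Y * ((k ∸ i) * (k C i))))    ≡⟨ pull-in (k ∸ i) a X Y _ ⟨
    (k ∸ i) * (a * (X * (Y * (k C i))))    ∎
    where
    open ≡-Reasoning
    a = 2 ^ k
    X = (2 * m ∸ 2 * k) C (m ∸ k)
    Y = (m + k) C k
    pull-in : ∀ c a X Y Z → c * (a * (X * (Y * Z))) ≡ a * (X * (Y * (c * Z)))
    pull-in = solve-∀

  summand-suc-≤ : ∀ {m k} i → k ≤ m → suc i * summand m (suc i) k ≤ (m ∸ i) * summand m i k
  summand-suc-≤ {m} {k} i k≤m = begin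
    suc i * summand m (suc i) k ≡⟨ summand-absorption m i k ⟩
    (k ∸ i) * summand m i k     ≤⟨ *-monoˡ-≤ (summand m i k) (∸-monoˡ-≤ i k≤m) ⟩
    (m ∸ i) * summand m i k     ∎
    where open ≤-Reasoning

  [j+1]*dNum[j+1]<[m∸j]*dNum[j] : ∀ {m j} → j < m → suc j * dNum m (suc j) < (m ∸ j) * dNum m j
  [j+1]*dNum[j+1]<[m∸j]*dNum[j] {m} {j} j<m = begin-strict
    suc j * dNum m (suc j)
      ≡⟨ cong (suc j *_) (dNum≡sumBelow-summand m (suc j)) ⟩
    suc j * sumBelow (suc (m ∸ suc j)) F
      ≡⟨ cong (λ n → suc j * sumBelow n F) (+-∸-assoc 1 j<m) ⟨
    suc j * sumBelow (m ∸ j) F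
      ≡⟨ *-distribˡ-sumBelow (suc j) (m ∸ j) F ⟩
    sumBelow (m ∸ j) (λ t → suc j * F t)
      ≤⟨ sumBelow-mono-≤ (m ∸ j) _ _ termwise ⟩
    sumBelow (m ∸ j) (λ t → (m ∸ j) * G (suc t))
      ≡⟨ *-distribˡ-sumBelow (m ∸ j) (m ∸ j) (λ t → G (suc t)) ⟨
    (m ∸ j) * S
      <⟨ *-monoʳ-< (m ∸ j) (m<n+m S (summand>0 (m≤m+n j 0) j+0≤m)) ⟩
    (m ∸ j) * (G 0 + S)
      ≡⟨ cong ((m ∸ j) *_) (sumBelow-shift (m ∸ j) G) ⟨
    (m ∸ j) * sumBelow (suc (m ∸ j)) G
      ≡⟨ cong ((m ∸ j) *_) (dNum≡sumBelow-summand m j) ⟨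
    (m ∸ j) * dNum m j
      ∎
    where
    open ≤-Reasoning
    instance _ = >-nonZero (m<n⇒0<n∸m j<m)
    F G : ℕ → ℕ
    F t = summand m (suc j) (suc j + t)
    G t = summand m j (j + t)
    S = sumBelow (m ∸ j) (λ t → G (suc t))
    j+0≤m : j + 0 ≤ m
    j+0≤m = subst (_≤ m) (sym (+-identityʳ j)) (<⇒≤ j<m)
    termwise : ∀ t → t < m ∸ j → suc j * F t ≤ (m ∸ j) * G (suc t)
    termwise t t<m∸j rewrite +-suc j t = summand-suc-≤ j (begin
      suc (j + t)      ≡⟨ +-suc j t ⟨
      j + suc t        ≤⟨ +-monoʳ-≤ j t<m∸j ⟩
      j + (m ∸ j)      ≡⟨ m+[n∸m]≡n (<⇒≤ j<m) ⟩
      m                ∎)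

module RationalCast where
  open import Data.Nat as ℕ using (ℕ; suc; NonZero)
  open import Data.Integer as ℤ using (+_)
  open import Data.Integer.Properties using (pos-*; *-monoʳ-<-pos)
  open import Data.Rational using (_<_; _*_; _/_; toℚᵘ)
  open import Data.Rational.Properties using (toℚᵘ-cancel-<; toℚᵘ-homo-*; toℚᵘ-fromℚᵘ)
  open import Data.Rational.Unnormalised as ℚᵘ using (mkℚᵘ; _≃_; *<*)
  open import Data.Rational.Unnormalised.Properties using (≃-trans; ≃-sym; *-cong; <-respˡ-≃; <-respʳ-≃)
  open import Relation.Binary.PropositionalEquality using (subst₂)

  toℚᵘ-[a/1*b/q] : ∀ a b q → toℚᵘ ((+ a / 1) * (+ b / suc q)) ≃ mkℚᵘ (+ a) 0 ℚᵘ.* mkℚᵘ (+ b) q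
  toℚᵘ-[a/1*b/q] a b q =
    ≃-trans (toℚᵘ-homo-* (+ a / 1) (+ b / suc q))
            (*-cong (toℚᵘ-fromℚᵘ (mkℚᵘ (+ a) 0)) (toℚᵘ-fromℚᵘ (mkℚᵘ (+ b) q)))

  a/1*b/q<c/1*e/q : ∀ a b c e q .{{_ : NonZero q}} → a ℕ.* b ℕ.< c ℕ.* e →
                    (+ a / 1) * (+ b / q) < (+ c / 1) * (+ e / q)
  a/1*b/q<c/1*e/q a b c e (suc q) ab<ce =
    toℚᵘ-cancel-< (<-respʳ-≃ (≃-sym (toℚᵘ-[a/1*b/q] c e q))
                  (<-respˡ-≃ (≃-sym (toℚᵘ-[a/1*b/q] a b q))
                  (*<* (*-monoʳ-<-pos _ (subst₂ ℤ._<_ (pos-* a b) (pos-* c e) (ℤ.+<+ ab<ce))))))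

open import Defs
open import Data.Nat using (ℕ; _≤_; _∸_; suc)
open import Data.Integer using (+_)
open import Data.Rational using (ℚ; _<_; _*_; _/_)
open import Data.Nat using (s≤s; _^_) renaming (_*_ to _*ℕ_)
open import Data.Nat.Properties using (m^n≢0)

lemma3p1 : (m : ℕ) → 2 ≤ m → (j : ℕ) → 1 ≤ j → j ≤ m ∸ 1 →
    (+ (suc j) / 1) * d m (suc j) < (+ (m ∸ j) / 1) * d m j
lemma3p1 (suc m) _ j _ j≤m =
  RationalCast.a/1*b/q<c/1*e/q (suc j) (dNum (suc m) (suc j)) (suc m ∸ j) (dNum (suc m) j)
    (2 ^ (2 *ℕ suc m)) {{m^n≢0 2 (2 *ℕ suc m)}}
    (BorosMollNumerator.[j+1]*dNum[j+1]<[m∸j]*dNum[j] (s≤s j≤m))
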